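{- If $T$ is a tree, then $\mathrm{sgc}(T) = 1$.
   Context: Graphs are finite and simple. For a graph $G$ and $S\subseteq V(G)$, one fixes for each unordered pair $\{x,y\}$ of distinct vertices of $S$ a single shortest $x,y$-path $\widetilde g(x,y)$; $S$ is a strong geodetic set if for some such choice the union of the vertex sets of the chosen paths equals $V(G)$ (for a one-vertex graph, that vertex forms a strong geodetic set). $\mathrm{sg}(G)$ is the minimum size of a strong geodetic set; a minimum one is an sg-set. For a strong geodetic set $S$, a set $X\subseteq S$ is a strong geodetic core for $S$ if there exists a choice of fixed shortest paths $\widetilde g(x,y)$ for pairs of $S$ such that $\bigcup_{(u,v)\in X\times S} V(\widetilde g(u,v)) = V(G)$. $\mathrm{sgc}(S)$ is the minimum size of a strong geodetic core for $S$, and $\mathrm{sgc}(G)=\min\{\mathrm{sgc}(S): S \text{ an sg-set of } G\}$. -}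

module Defs where

open import Data.Nat using (ℕ; zero; suc; _≤_)
open import Data.Bool using (Bool; true; false; T)
open import Data.Fin using (Fin)
open import Data.Fin.Subset using (Subset; _∈_; _⊆_; ∣_∣)
open import Data.List using (List; []; _∷_; reverse)
open import Data.List.Relation.Unary.Unique.Propositional using (Unique)
import Data.List.Membership.Propositional as LM
open import Data.Product using (Σ; ∃; ∃-syntax; _×_; _,_)
open import Relation.Binary.PropositionalEquality using (_≡_)
open import Relation.Nullary using (¬_)

record Graph : Set where
  field
    n      : ℕ
    adj    : Fin n → Fin n → Bool
    sym    : ∀ x y → adj x y ≡ adj y x
    irrefl : ∀ x → adj x x ≡ false

open Graph public

module _ (G : Graph) where

  V : Set
  V = Fin (n G)

  Adj : V → V → Set
  Adj x y = T (adj G x y)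

  data Walk : V → V → Set where
    nil  : ∀ x → Walk x x
    cons : ∀ {x y z} → Adj x y → Walk y z → Walk x z

  len : ∀ {x y} → Walk x y → ℕ
  len (nil _)    = 0
  len (cons _ w) = suc (len w)

  verts : ∀ {x y} → Walk x y → List V
  verts (nil x)             = x ∷ []
  verts (cons {x} _ w)      = x ∷ verts w

  IsShortest : ∀ {x y} → Walk x y → Set
  IsShortest {x} {y} w = ∀ (w' : Walk x y) → len w ≤ len w'

  Connected : Set
  Connected = ∀ (x y : V) → Walk x y

  -- no cycle: a cycle is x, y, ..., x with edge xy, |cycle| ≥ 3, vertices y..x distinct
  Acyclic : Set
  Acyclic = ∀ {x y} (e : Adj x y) (w : Walk y x) → 2 ≤ len w → ¬ Unique (verts w)

  IsTree : Set
  IsTree = 1 ≤ n G × Connected × Acyclic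

  -- a choice of fixed shortest paths for the pairs of S; one path per unordered pair
  -- (g y x is the reverse of g x y); for x = y the path is the trivial one.
  Choice : Subset (n G) → Set
  Choice S = ∀ x y → x ∈ S → y ∈ S → Walk x y

  ValidChoice : (S : Subset (n G)) → Choice S → Set
  ValidChoice S g = ∀ x y (px : x ∈ S) (py : y ∈ S) →
    IsShortest (g x y px py) × verts (g y x py px) ≡ reverse (verts (g x y px py))

  Covers : (S X : Subset (n G)) → X ⊆ S → Choice S → Set
  Covers S X sub g = ∀ (v : V) → ∃[ u ] ∃[ w ] Σ (u ∈ X) λ pu → Σ (w ∈ S) λ pw →
    LM._∈_ v (verts (g u w (sub pu) pw))

  -- strong geodetic set: some valid choice whose paths cover V
  -- (diagonal pairs contribute trivial paths; this realises the one-vertex convention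
  --  and changes nothing when |S| ≥ 2)
  StrongGeodetic : Subset (n G) → Set
  StrongGeodetic S = Σ (Choice S) λ g → ValidChoice S g × Covers S S (λ p → p) g

  IsSgSet : Subset (n G) → Set
  IsSgSet S = StrongGeodetic S × (∀ S' → StrongGeodetic S' → ∣ S ∣ ≤ ∣ S' ∣)

  IsCore : (S X : Subset (n G)) → Set
  IsCore S X = StrongGeodetic S × Σ (X ⊆ S) λ sub →
    Σ (Choice S) λ g → ValidChoice S g × Covers S X sub g

  SgcIs : ℕ → Set
  SgcIs k = (Σ (Subset (n G)) λ S → Σ (Subset (n G)) λ X → IsSgSet S × IsCore S X × ∣ X ∣ ≡ k)
          × (∀ S X → IsSgSet S → IsCore S X → k ≤ ∣ X ∣)

module Submission where

-- (1) In any graph a leaf lying on a shortest path is one of its endpoints, so every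
--     strong geodetic set contains all leaves.  Hence, once the set L of leaves is
--     shown to be strong geodetic, L is an sg-set.
-- (2) In a tree, fix a leaf u and canonical shortest paths between all pairs.  For any
--     vertex v pick w maximising d(u,w) subject to d(u,w) = d(u,v) + d(v,w).  No
--     neighbour of w is farther from u than w, and in a tree such a vertex is a leaf
--     (two such neighbours would close a cycle through w).  Since geodesics of a tree
--     are unique, v lies on the chosen u,w-path.  So the paths from u alone cover
--     the tree: L is strong geodetic and {u} is a core of it.
-- A core is never empty (it covers the nonempty vertex set), so sgc(T) = 1.

open import Defs
open import Data.Nat using (ℕ; zero; suc; _+_; _≤_; z≤n; s≤s; s≤s⁻¹; _≤?_; _≟_)
open import Data.Nat.Properties
open import Data.Bool using (true; T)
open import Data.Fin using (Fin; fromℕ<)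
import Data.Fin.Properties as Fin
open import Data.Fin.Subset using (Subset; ⁅_⁆; ∣_∣; _⊆_) renaming (_∈_ to _∈ₛ_)
import Data.Fin.Subset.Properties as Subset
open import Data.List using (List; []; _∷_; reverse; _++_; [_]; allFin; upTo; filter)
open import Data.List.Properties using (unfold-reverse; reverse-involutive)
open import Data.List.Relation.Unary.Any using (here; there)
import Data.List.Relation.Unary.Any.Properties as Any
open import Data.List.Relation.Unary.All using (lookup) renaming ([] to []ᵃ)
open import Data.List.Relation.Unary.All.Properties using (all-filter; ¬Any⇒All¬)
open import Data.List.Relation.Unary.AllPairs using ([]; _∷_)
open import Data.List.Relation.Unary.Unique.Propositional using (Unique)
open import Data.List.Membership.Propositional using (_∈_; _∉_)
open import Data.List.Membership.Propositional.Properties using (∈-allFin; ∈-upTo⁺; ∈-filter⁺)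
open import Data.List.Extrema.Nat using (argmax; argmin; argmax-all; argmin-all; f[xs]≤f[argmax]; f[argmin]≤f[xs]; f[argmin]≤f[⊤])
import Data.List.Membership.DecPropositional as DecMembership
import Data.Vec as Vec
import Data.Vec.Properties as Vec
open import Data.Product using (Σ; _×_; _,_; proj₁; proj₂)
open import Data.Sum using (_⊎_; inj₁; inj₂)
open import Data.Empty using (⊥; ⊥-elim)
open import Function using (id)
open import Level using (Level)
open import Relation.Binary.PropositionalEquality using (_≡_; refl; trans; cong; subst; subst₂; module ≡-Reasoning) renaming (sym to ≡-sym)
open import Relation.Nullary using (¬_; Dec; yes; no; does)
open import Relation.Nullary.Decidable using (T?; _×-dec_; _→-dec_; dec-true)
open import Relation.Unary using (Pred; Decidable)

private variable ℓ : Level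

leastWitness : {Q : Pred ℕ ℓ} → Decidable Q → ∀ {L} → Q L →
               Σ ℕ λ k → Q k × (∀ j → Q j → k ≤ j)
leastWitness {Q = Q} Q? {L} qL = k , argmin-all id qL (all-filter Q? (upTo (suc L))) , minimal
  where
  candidates : List ℕ
  candidates = filter Q? (upTo (suc L))
  k : ℕ
  k = argmin id L candidates
  minimal : ∀ j → Q j → k ≤ j
  minimal j qj with j ≤? L
  ... | yes j≤L = lookup (f[argmin]≤f[xs] {f = id} L candidates) (∈-filter⁺ Q? (∈-upTo⁺ (s≤s j≤L)) qj)
  ... | no j≰L  = ≤-trans (f[argmin]≤f[⊤] {f = id} L candidates) (<⇒≤ (≰⇒> j≰L))

constrainedMax : ∀ {k} {Q : Pred (Fin k) ℓ} → Decidable Q → (f : Fin k → ℕ) → ∀ {w₀} → Q w₀ →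
                 Σ (Fin k) λ w → Q w × (∀ x → Q x → f x ≤ f w)
constrainedMax {k = k} {Q = Q} Q? f {w₀} q₀ = w , argmax-all f q₀ (all-filter Q? (allFin k)) , maximal
  where
  candidates : List (Fin k)
  candidates = filter Q? (allFin k)
  w : Fin k
  w = argmax f w₀ candidates
  maximal : ∀ x → Q x → f x ≤ f w
  maximal x qx = lookup (f[xs]≤f[argmax] w₀ candidates) (∈-filter⁺ Q? (∈-allFin x) qx)

subsetOf : ∀ {k} {P : Pred (Fin k) ℓ} → Decidable P → Subset k
subsetOf P? = Vec.tabulate (λ x → does (P? x))

∈-subsetOf⁺ : ∀ {k} {P : Pred (Fin k) ℓ} (P? : Decidable P) {x} → P x → x ∈ₛ subsetOf P?
∈-subsetOf⁺ P? {x} px =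
  Vec.lookup⇒[]= x (subsetOf P?) (trans (Vec.lookup∘tabulate _ x) (dec-true (P? x) px))

∈-subsetOf⁻ : ∀ {k} {P : Pred (Fin k) ℓ} (P? : Decidable P) {x} → x ∈ₛ subsetOf P? → P x
∈-subsetOf⁻ P? {x} x∈ = witness (P? x) (trans (≡-sym (Vec.lookup∘tabulate _ x)) (Vec.[]=⇒lookup x∈))
  where
  witness : ∀ {A : Set ℓ} (a? : Dec A) → does a? ≡ true → A
  witness (yes a) _ = a

module Walks (G : Graph) where

  open DecMembership (Fin._≟_ {n G}) using (_∈?_)

  adj-sym : ∀ {x y} → Adj G x y → Adj G y x
  adj-sym {x} {y} e = subst T (Graph.sym G x y) e

  adj-irrefl : ∀ {x} → ¬ Adj G x x
  adj-irrefl {x} e = subst T (irrefl G x) e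

  adj? : ∀ x y → Dec (Adj G x y)
  adj? x y = T? (adj G x y)

  _++ʷ_ : ∀ {x y z} → Walk G x y → Walk G y z → Walk G x z
  nil _    ++ʷ q = q
  cons e p ++ʷ q = cons e (p ++ʷ q)

  len-++ʷ : ∀ {x y z} (p : Walk G x y) (q : Walk G y z) → len G (p ++ʷ q) ≡ len G p + len G q
  len-++ʷ (nil _)    q = refl
  len-++ʷ (cons e p) q = cong suc (len-++ʷ p q)

  ∈-++ʷ⁻ : ∀ {x y z v} (p : Walk G x y) (q : Walk G y z) →
           v ∈ verts G (p ++ʷ q) → v ∈ verts G p ⊎ v ∈ verts G q
  ∈-++ʷ⁻ (nil _)    q v∈         = inj₂ v∈
  ∈-++ʷ⁻ (cons e p) q (here v≡x) = inj₁ (here v≡x)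
  ∈-++ʷ⁻ (cons e p) q (there v∈) with ∈-++ʷ⁻ p q v∈
  ... | inj₁ v∈p = inj₁ (there v∈p)
  ... | inj₂ v∈q = inj₂ v∈q

  snocʷ : ∀ {x y z} → Walk G x y → Adj G y z → Walk G x z
  snocʷ p e = p ++ʷ cons e (nil _)

  len-snocʷ : ∀ {x y z} (p : Walk G x y) (e : Adj G y z) → len G (snocʷ p e) ≡ suc (len G p)
  len-snocʷ p e = trans (len-++ʷ p (cons e (nil _))) (+-comm (len G p) 1)

  verts-snocʷ : ∀ {x y z} (p : Walk G x y) (e : Adj G y z) → verts G (snocʷ p e) ≡ verts G p ++ [ z ]
  verts-snocʷ (nil _)     e = refl
  verts-snocʷ (cons e′ p) e = cong (_ ∷_) (verts-snocʷ p e)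

  reverseʷ : ∀ {x y} → Walk G x y → Walk G y x
  reverseʷ (nil x)    = nil x
  reverseʷ (cons e p) = snocʷ (reverseʷ p) (adj-sym e)

  len-reverseʷ : ∀ {x y} (p : Walk G x y) → len G (reverseʷ p) ≡ len G p
  len-reverseʷ (nil _)    = refl
  len-reverseʷ (cons e p) = trans (len-snocʷ (reverseʷ p) (adj-sym e)) (cong suc (len-reverseʷ p))

  verts-reverseʷ : ∀ {x y} (p : Walk G x y) → verts G (reverseʷ p) ≡ reverse (verts G p)
  verts-reverseʷ (nil _)        = refl
  verts-reverseʷ (cons {x} e p) = begin
    verts G (snocʷ (reverseʷ p) (adj-sym e)) ≡⟨ verts-snocʷ (reverseʷ p) (adj-sym e) ⟩
    verts G (reverseʷ p) ++ [ x ]            ≡⟨ cong (_++ [ x ]) (verts-reverseʷ p) ⟩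
    reverse (verts G p) ++ [ x ]             ≡⟨ ≡-sym (unfold-reverse x (verts G p)) ⟩
    reverse (x ∷ verts G p)                  ∎
    where open ≡-Reasoning

  ∈-reverseʷ⁻ : ∀ {x y v} (p : Walk G x y) → v ∈ verts G (reverseʷ p) → v ∈ verts G p
  ∈-reverseʷ⁻ p v∈ = Any.reverse⁻ (subst (_ ∈_) (verts-reverseʷ p) v∈)

  splitʷ : ∀ {x y v} (p : Walk G x y) → v ∈ verts G p →
           Σ (Walk G x v) λ p₁ → Σ (Walk G v y) λ p₂ → len G p₁ + len G p₂ ≡ len G p
  splitʷ (nil _)    (here refl) = nil _ , nil _ , refl
  splitʷ (cons e p) (here refl) = nil _ , cons e p , refl
  splitʷ (cons e p) (there v∈) with splitʷ p v∈
  ... | p₁ , p₂ , eq = cons e p₁ , p₂ , cong suc eq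

  _⊆ᵛ_ : ∀ {x y x′ y′} → Walk G x y → Walk G x′ y′ → Set
  p ⊆ᵛ q = ∀ {v} → v ∈ verts G p → v ∈ verts G q

  suffixPath : ∀ {x y v} (p : Walk G x y) → Unique (verts G p) → v ∈ verts G p →
               Σ (Walk G v y) λ q → Unique (verts G q) × q ⊆ᵛ p
  suffixPath (nil _)    u         (here refl) = nil _ , u , id
  suffixPath (cons e p) u         (here refl) = cons e p , u , id
  suffixPath (cons e p) (_ ∷ u)  (there v∈) with suffixPath p u v∈
  ... | q , uq , q⊆p = q , uq , λ w∈ → there (q⊆p w∈)

  pathIn : ∀ {x y} (w : Walk G x y) → Σ (Walk G x y) λ p → Unique (verts G p) × p ⊆ᵛ w
  pathIn (nil x) = nil x , ([]ᵃ ∷ []) , id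
  pathIn (cons {x} e w) with pathIn w
  ... | p , up , p⊆w with x ∈? verts G p
  ...   | yes x∈p with suffixPath p up x∈p
  ...     | q , uq , q⊆p = q , uq , λ v∈ → there (p⊆w (q⊆p v∈))
  pathIn (cons {x} e w) | p , up , p⊆w | no x∉p =
    cons e p , (¬Any⇒All¬ (verts G p) x∉p ∷ up) , λ { (here v≡x) → here v≡x ; (there v∈) → there (p⊆w v∈) }

  WalkOfLength : V G → V G → ℕ → Set
  WalkOfLength x y k = Σ (Walk G x y) λ w → len G w ≡ k

  walkOfLength? : ∀ k x y → Dec (WalkOfLength x y k)
  walkOfLength? zero x y with x Fin.≟ y
  ... | yes refl = yes (nil x , refl)
  ... | no x≢y   = no λ { (nil _ , _) → x≢y refl ; (cons _ _ , ()) }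
  walkOfLength? (suc k) x y with Fin.any? (λ z → adj? x z ×-dec walkOfLength? k z y)
  ... | yes (z , e , w , len≡k) = yes (cons e w , cong suc len≡k)
  ... | no none = no λ { (nil _ , ()) ; (cons e w , len≡) → none (_ , e , w , suc-injective len≡) }

  shortest-tail : ∀ {x y z} (e : Adj G x y) (w : Walk G y z) → IsShortest G (cons e w) → IsShortest G w
  shortest-tail e w shortest w′ = s≤s⁻¹ (shortest (cons e w′))

  shortest-reverse : ∀ {x y} (w : Walk G x y) → IsShortest G w → IsShortest G (reverseʷ w)
  shortest-reverse w shortest w′ =
    subst₂ _≤_ (≡-sym (len-reverseʷ w)) (len-reverseʷ w′) (shortest (reverseʷ w′))

  verts-len0 : ∀ {x} (w : Walk G x x) → len G w ≡ 0 → verts G w ≡ x ∷ []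
  verts-len0 (nil _) _ = refl

module Distance (G : Graph) (connected : Connected G) where
  open Walks G

  shortestWalk : ∀ x y → Σ (Walk G x y) (IsShortest G)
  shortestWalk x y with leastWitness (λ k → walkOfLength? k x y) (connected x y , refl)
  ... | k , (w , len≡k) , minimal =
    w , λ w′ → subst (_≤ len G w′) (≡-sym len≡k) (minimal (len G w′) (w′ , refl))

  geodesic : ∀ x y → Walk G x y
  geodesic x y = proj₁ (shortestWalk x y)

  geodesic-shortest : ∀ x y → IsShortest G (geodesic x y)
  geodesic-shortest x y = proj₂ (shortestWalk x y)

  dist : V G → V G → ℕ
  dist x y = len G (geodesic x y)

  dist-≤-len : ∀ {x y} (w : Walk G x y) → dist x y ≤ len G w
  dist-≤-len {x} {y} = geodesic-shortest x y

  shortest⇒len≤dist : ∀ {x y} (w : Walk G x y) → IsShortest G w → len G w ≤ dist x y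
  shortest⇒len≤dist {x} {y} w shortest = shortest (geodesic x y)

  dist-self : ∀ x → dist x x ≡ 0
  dist-self x = n≤0⇒n≡0 (dist-≤-len (nil x))

  dist-sym : ∀ x y → dist x y ≤ dist y x
  dist-sym x y = subst (dist x y ≤_) (len-reverseʷ (geodesic y x)) (dist-≤-len (reverseʷ (geodesic y x)))

  dist-triangle : ∀ x y z → dist x z ≤ dist x y + dist y z
  dist-triangle x y z =
    subst (dist x z ≤_) (len-++ʷ (geodesic x y) (geodesic y z)) (dist-≤-len (geodesic x y ++ʷ geodesic y z))

  dist-edge : ∀ x {y z} → Adj G y z → dist x z ≤ suc (dist x y)
  dist-edge x {y} e = subst (dist x _ ≤_) (len-snocʷ (geodesic x y) e) (dist-≤-len (snocʷ (geodesic x y) e))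

  -- A geodesic from r to z does not pass through a neighbour m of z with dist r z ≤ dist r m:
  -- the part of it before m would already be shorter than dist r z.
  geodesic-avoids : ∀ {r m z} → Adj G m z → dist r z ≤ dist r m → m ∉ verts G (geodesic r z)
  geodesic-avoids {r} {m} {z} e z-near m∈ with splitʷ (geodesic r z) m∈
  ... | p₁ , nil _      , _   = adj-irrefl e
  ... | p₁ , cons _ p₂ , eq =
    m+1+n≰m (len G p₁) (≤-trans (≤-reflexive eq) (≤-trans z-near (dist-≤-len p₁)))

module Leaves (G : Graph) where
  open Walks G

  -- v has at most one neighbour (isolated vertices count as leaves).
  Leaf : V G → Set
  Leaf v = ∀ a b → Adj G v a → Adj G v b → a ≡ b

  leaf? : Decidable Leaf
  leaf? v = Fin.all? λ a → Fin.all? λ b → adj? v a →-dec (adj? v b →-dec (a Fin.≟ b))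

  -- A leaf lying on a shortest walk is one of its endpoints: passing through a leaf means
  -- entering and leaving it along the same edge, which a shortest walk never does.
  leaf-on-shortest : ∀ {a b v} (w : Walk G a b) → IsShortest G w → Leaf v → v ∈ verts G w → v ≡ a ⊎ v ≡ b
  leaf-on-shortest (nil _)    _        _    (here refl) = inj₁ refl
  leaf-on-shortest (cons e w) _        _    (here refl) = inj₁ refl
  leaf-on-shortest (cons e w) shortest leaf (there v∈) with leaf-on-shortest w (shortest-tail e w shortest) leaf v∈
  ... | inj₂ v≡b  = inj₂ v≡b
  ... | inj₁ refl = second-vertex-is-last e w shortest leaf
    where
    second-vertex-is-last : ∀ {a v b} (e : Adj G a v) (w : Walk G v b) →
                            IsShortest G (cons e w) → Leaf v → v ≡ a ⊎ v ≡ b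
    second-vertex-is-last e (nil _)      _        _    = inj₂ refl
    second-vertex-is-last {a} e (cons e′ w′) shortest leaf with leaf a _ (adj-sym e) e′
    ... | refl = ⊥-elim (1+n≰n (≤-trans (n≤1+n _) (shortest w′)))

  leafSet : Subset (n G)
  leafSet = subsetOf leaf?

  leafSet⊆strongGeodetic : ∀ S → StrongGeodetic G S → leafSet ⊆ S
  leafSet⊆strongGeodetic S (g , valid , covers) {v} v∈leaves with covers v
  ... | a , b , a∈S , b∈S , v∈path
    with leaf-on-shortest (g a b a∈S b∈S) (proj₁ (valid a b a∈S b∈S)) (∈-subsetOf⁻ leaf? v∈leaves) v∈path
  ... | inj₁ refl = a∈S
  ... | inj₂ refl = b∈S

covers-from-all : ∀ G {S X} (X⊆S : X ⊆ S) (g : Choice G S) → Covers G S X X⊆S g → Covers G S S id g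
covers-from-all G X⊆S g covers v with covers v
... | a , b , a∈X , b∈S , v∈path = a , b , X⊆S a∈X , b∈S , v∈path

core-nonempty : ∀ G (r : V G) {S X} → IsCore G S X → 1 ≤ ∣ X ∣
core-nonempty G r {X = X} (_ , _ , _ , _ , covers) with covers r
... | a , _ , a∈X , _ = subst (_≤ ∣ X ∣) (Subset.∣⁅x⁆∣≡1 a) (Subset.p⊆q⇒∣p∣≤∣q∣ ⁅a⁆⊆X)
  where
  ⁅a⁆⊆X : ⁅ a ⁆ ⊆ X
  ⁅a⁆⊆X x∈ with Subset.x∈⁅y⁆⇒x≡y a x∈
  ... | refl = a∈X

module TreeFacts (G : Graph) (connected : Connected G) (acyclic : Acyclic G) where
  open Walks G
  open Distance G connected
  open Leaves G

  -- Seen from a root r, no vertex m has two distinct neighbours that are no farther from r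
  -- than m: their geodesics to r avoid m, and together with m they would close a cycle.
  no-two-near-neighbours : ∀ r m z₁ z₂ → Adj G m z₁ → Adj G m z₂ → ¬ z₁ ≡ z₂ →
                           dist r z₁ ≤ dist r m → dist r z₂ ≤ dist r m → ⊥
  no-two-near-neighbours r m z₁ z₂ e₁ e₂ z₁≢z₂ near₁ near₂
    with pathIn (reverseʷ (geodesic r z₂) ++ʷ geodesic r z₁)
  ... | nil _       , _      , _    = z₁≢z₂ refl
  ... | cons e′ p′ , unique , p⊆w =
    -- the cycle z₁, m, z₂, …, z₁
    acyclic (adj-sym e₁) (cons e₂ (cons e′ p′)) (s≤s (s≤s z≤n)) (¬Any⇒All¬ _ m∉p ∷ unique)
    where
    m∉p : m ∉ verts G (cons e′ p′)
    m∉p m∈ with ∈-++ʷ⁻ (reverseʷ (geodesic r z₂)) (geodesic r z₁) (p⊆w m∈)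
    ... | inj₁ m∈₂ = geodesic-avoids e₂ near₂ (∈-reverseʷ⁻ (geodesic r z₂) m∈₂)
    ... | inj₂ m∈₁ = geodesic-avoids e₁ near₁ m∈₁

  locally-farthest⇒leaf : ∀ r w → (∀ z → Adj G w z → dist r z ≤ dist r w) → Leaf w
  locally-farthest⇒leaf r w no-farther a b e₁ e₂ with a Fin.≟ b
  ... | yes a≡b = a≡b
  ... | no a≢b  = ⊥-elim (no-two-near-neighbours r w a b e₁ e₂ a≢b (no-farther a e₁) (no-farther b e₂))

  -- Geodesics are unique: a vertex v reachable from a in len S steps with
  -- len S + dist v b ≤ len P lies on every shortest a,b-walk P.  Both P and the route
  -- through v must leave a along the same edge, as both first steps get closer to b.
  on-every-geodesic : ∀ {a b v} (P : Walk G a b) → IsShortest G P →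
                      (S : Walk G a v) → len G S + dist v b ≤ len G P → v ∈ verts G P
  on-every-geodesic (nil _)    _ (nil _)    _ = here refl
  on-every-geodesic (cons e P) _ (nil _)    _ = here refl
  on-every-geodesic {a} {b} {v} (cons {y = a₁} e₁ P) shortest (cons {y = a₂} e₂ S) bound
    with a₁ Fin.≟ a₂
  ... | yes refl = there (on-every-geodesic P (shortest-tail e₁ P shortest) S (s≤s⁻¹ bound))
  ... | no a₁≢a₂ = ⊥-elim (no-two-near-neighbours b a a₁ a₂ e₁ e₂ a₁≢a₂ near₁ near₂)
    where
    len-P≤dist : len G P ≤ dist b a
    len-P≤dist = ≤-trans (n≤1+n _) (≤-trans (shortest⇒len≤dist (cons e₁ P) shortest) (dist-sym a b))
    near₁ : dist b a₁ ≤ dist b a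
    near₁ = ≤-trans (dist-sym b a₁) (≤-trans (dist-≤-len P) len-P≤dist)
    near₂ : dist b a₂ ≤ dist b a
    near₂ = begin
      dist b a₂              ≤⟨ dist-sym b a₂ ⟩
      dist a₂ b              ≤⟨ dist-triangle a₂ v b ⟩
      dist a₂ v + dist v b   ≤⟨ +-monoˡ-≤ (dist v b) (dist-≤-len S) ⟩
      len G S + dist v b     ≤⟨ s≤s⁻¹ bound ⟩
      len G P                ≤⟨ len-P≤dist ⟩
      dist b a               ∎
      where open ≤-Reasoning

  -- Canonical geodesics for all pairs: the chosen geodesic from the smaller endpoint,
  -- reversed when read from the larger one, so that both directions use the same path.
  canonical : ∀ x y → Walk G x y
  canonical x y with x Fin.≤? y
  ... | yes _ = geodesic x y
  ... | no _  = reverseʷ (geodesic y x)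

  canonical-valid : ∀ x y → IsShortest G (canonical x y) × verts G (canonical y x) ≡ reverse (verts G (canonical x y))
  canonical-valid x y with x Fin.≤? y | y Fin.≤? x
  ... | yes x≤y | yes y≤x with Fin.≤-antisym x≤y y≤x
  ...   | refl = geodesic-shortest x x , trans trivial (≡-sym (cong reverse trivial))
    where
    trivial : verts G (geodesic x x) ≡ x ∷ []
    trivial = verts-len0 (geodesic x x) (dist-self x)
  canonical-valid x y | yes _ | no _ = geodesic-shortest x y , verts-reverseʷ (geodesic x y)
  canonical-valid x y | no _  | yes _ =
    shortest-reverse (geodesic y x) (geodesic-shortest y x) ,
    trans (≡-sym (reverse-involutive _)) (cong reverse (≡-sym (verts-reverseʷ (geodesic y x))))
  canonical-valid x y | no x≰y | no y≰x with Fin.≤-total x y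
  ... | inj₁ x≤y = ⊥-elim (x≰y x≤y)
  ... | inj₂ y≤x = ⊥-elim (y≰x y≤x)

  Between : V G → V G → V G → Set
  Between u v x = dist u x ≡ dist u v + dist v x

  -- If w is farthest from u among the vertices x with v between u and x, then no
  -- neighbour of w is farther from u, so w is a leaf; and v lies on the canonical
  -- u,w-path by uniqueness of geodesics.
  farthest-beyond : ∀ u v w → Between u v w → (∀ x → Between u v x → dist u x ≤ dist u w) →
                    Leaf w × v ∈ verts G (canonical u w)
  farthest-beyond u v w w-beyond-v farthest =
    locally-farthest⇒leaf u w no-farther ,
    on-every-geodesic (canonical u w) (proj₁ (canonical-valid u w)) (geodesic u v)
      (≤-trans (≤-reflexive (≡-sym w-beyond-v)) (dist-≤-len (canonical u w)))
    where
    no-farther : ∀ z → Adj G w z → dist u z ≤ dist u w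
    no-farther z e with dist u z ≤? dist u w
    ... | yes z-near = z-near
    ... | no z-far   = ⊥-elim (z-far (farthest z z-beyond-v))
      where
      z-beyond-v : Between u v z
      z-beyond-v = ≤-antisym (dist-triangle u v z) (begin
        dist u v + dist v z         ≤⟨ +-monoʳ-≤ (dist u v) (dist-edge v e) ⟩
        dist u v + suc (dist v w)   ≡⟨ +-suc (dist u v) (dist v w) ⟩
        suc (dist u v + dist v w)   ≡⟨ cong suc (≡-sym w-beyond-v) ⟩
        suc (dist u w)              ≤⟨ ≰⇒> z-far ⟩
        dist u z                    ∎)
        where open ≤-Reasoning

  -- Hence from any vertex u, each vertex v lies on the canonical path from u to some leaf
  -- (v is between u and v itself, so a farthest vertex with v between exists).
  covered-from : ∀ u v → Σ (V G) λ w → Leaf w × v ∈ verts G (canonical u w)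
  covered-from u v = w , farthest-beyond u v w w-beyond-v farthest
    where
    v-beyond-v : Between u v v
    v-beyond-v = ≡-sym (trans (cong (dist u v +_) (dist-self v)) (+-identityʳ (dist u v)))
    maximum : Σ (V G) λ w → Between u v w × (∀ x → Between u v x → dist u x ≤ dist u w)
    maximum = constrainedMax (λ x → dist u x ≟ dist u v + dist v x) (dist u) v-beyond-v
    w : V G
    w = proj₁ maximum
    w-beyond-v : Between u v w
    w-beyond-v = proj₁ (proj₂ maximum)
    farthest : ∀ x → Between u v x → dist u x ≤ dist u w
    farthest = proj₂ (proj₂ maximum)

  canonicalChoice : Choice G leafSet
  canonicalChoice x y _ _ = canonical x y

  canonicalChoice-valid : ValidChoice G leafSet canonicalChoice
  canonicalChoice-valid x y _ _ = canonical-valid x y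

  -- A tree with a vertex r has a leaf: the one found when covering r from r itself.
  someLeaf : V G → Σ (V G) Leaf
  someLeaf r = proj₁ (covered-from r r) , proj₁ (proj₂ (covered-from r r))

  module _ {u : V G} (u-leaf : Leaf u) where

    ⁅u⁆⊆leafSet : ⁅ u ⁆ ⊆ leafSet
    ⁅u⁆⊆leafSet x∈ with Subset.x∈⁅y⁆⇒x≡y u x∈
    ... | refl = ∈-subsetOf⁺ leaf? u-leaf

    covered-by-leaf : Covers G leafSet ⁅ u ⁆ ⁅u⁆⊆leafSet canonicalChoice
    covered-by-leaf v =
      u , proj₁ (covered-from u v) , Subset.x∈⁅x⁆ u ,
      ∈-subsetOf⁺ leaf? (proj₁ (proj₂ (covered-from u v))) , proj₂ (proj₂ (covered-from u v))

    leafSet-strongGeodetic : StrongGeodetic G leafSet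
    leafSet-strongGeodetic =
      canonicalChoice , canonicalChoice-valid ,
      covers-from-all G ⁅u⁆⊆leafSet canonicalChoice covered-by-leaf

    leafSet-sgSet : IsSgSet G leafSet
    leafSet-sgSet = leafSet-strongGeodetic , λ S S-sg → Subset.p⊆q⇒∣p∣≤∣q∣ (leafSet⊆strongGeodetic S S-sg)

    ⁅u⁆-core : IsCore G leafSet ⁅ u ⁆
    ⁅u⁆-core = leafSet-strongGeodetic , ⁅u⁆⊆leafSet , canonicalChoice , canonicalChoice-valid , covered-by-leaf

lemma3p1 : (T : Graph) → IsTree T → SgcIs T 1
lemma3p1 T (nonempty , connected , acyclic) =
  (leafSet , ⁅ u ⁆ , leafSet-sgSet u-leaf , ⁅u⁆-core u-leaf , Subset.∣⁅x⁆∣≡1 u) ,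
  λ S X _ X-core → core-nonempty T root X-core
  where
  open Leaves T
  open TreeFacts T connected acyclic
  root : V T
  root = fromℕ< nonempty
  u : V T
  u = proj₁ (someLeaf root)
  u-leaf : Leaf u
  u-leaf = proj₂ (someLeaf root)
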